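{- There exist a finite non-empty set of agents $N$, a coalition $C\subseteq N$, and formulas $\varphi,\psi$ such that $\models\varphi\rightarrow\psi$ but $\not\models\mathrm{Iab}_C\varphi\rightarrow\mathrm{Iab}_C\psi$.
   Context: A coalition is any $C\subseteq N$, $\overline{C}=N\setminus C$. Formulas: $\varphi ::= p \mid \neg\varphi \mid (\varphi\wedge\psi) \mid [C]\varphi \mid \mathrm{Iab}_C\varphi$ over a countable set $\mathrm{Prop}$ of variables, with $\vee,\rightarrow$ as usual. A coalition model is $\mathcal{M}=(S,\{Act_i\}_{i\in N},o,V)$ with $S$ non-empty, each $Act_i$ non-empty, $o:S\times\prod_{i\in N}Act_i\to S$, $V:\mathrm{Prop}\to 2^S$; $Act_C=\prod_{i\in C}Act_i$. $\mathcal{M},s\models[C]\varphi$ iff there is $\sigma_C\in Act_C$ such that for all $\sigma_{\overline{C}}\in Act_{\overline{C}}$, $\mathcal{M},o(s,\sigma_C,\sigma_{\overline{C}})\models\varphi$; $\mathcal{M},s\models\mathrm{Iab}_C\varphi$ iff $\mathcal{M},s\not\models[C]\varphi$; atoms and Boolean connectives as usual. $\models\varphi$ means $\varphi$ holds at every state of every coalition model over $N$. -}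

module Defs where

open import Data.Nat using (ℕ; suc)
open import Data.Fin using (Fin)
open import Data.Bool using (Bool; true; false; not)
open import Data.Product using (_×_; Σ)
open import Data.Empty using (⊥)
open import Relation.Nullary using (¬_)
open import Relation.Binary.PropositionalEquality using (_≡_; refl; cong)
open import Level using (0ℓ) renaming (suc to lsuc)

-- Agents: N = Fin n.  A coalition is a (decidable) subset C : Fin n → Bool.
Coalition : ℕ → Set
Coalition n = Fin n → Bool

co : ∀ {n} → Coalition n → Coalition n
co C i = not (C i)

Var : Set
Var = ℕ

data Form (n : ℕ) : Set where
  var  : Var → Form n
  ¬'_  : Form n → Form n
  _∧'_ : Form n → Form n → Form n
  [_]_ : Coalition n → Form n → Form n
  Iab  : Coalition n → Form n → Form n

_∨'_ : ∀ {n} → Form n → Form n → Form n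
φ ∨' ψ = ¬' ((¬' φ) ∧' (¬' ψ))

_⇒'_ : ∀ {n} → Form n → Form n → Form n
φ ⇒' ψ = ¬' (φ ∧' (¬' ψ))

record Model (n : ℕ) : Set₁ where
  field
    S    : Set
    s₀   : S                       -- S non-empty
    Act  : Fin n → Set
    act₀ : (i : Fin n) → Act i     -- each Act_i non-empty
    o    : S → ((i : Fin n) → Act i) → S
    V    : Var → S → Set

ActC : ∀ {n} (M : Model n) → Coalition n → Set
ActC {n} M C = (i : Fin n) → C i ≡ true → Model.Act M i

merge : ∀ {n} (M : Model n) (C : Coalition n) →
        ActC M C → ActC M (co C) → (i : Fin n) → Model.Act M i
merge M C σ τ i with C i in eq
... | true  = σ i eq
... | false = τ i (cong not eq)

infix 4 _,_⊨_
_,_⊨_ : ∀ {n} (M : Model n) → Model.S M → Form n → Set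
M , s ⊨ var p = Model.V M p s
M , s ⊨ (¬' φ) = ¬ (M , s ⊨ φ)
M , s ⊨ (φ ∧' ψ) = (M , s ⊨ φ) × (M , s ⊨ ψ)
M , s ⊨ ([ C ] φ) = Σ (ActC M C) λ σ → (τ : ActC M (co C)) →
                      M , Model.o M s (merge M C σ τ) ⊨ φ
M , s ⊨ Iab C φ = ¬ (Σ (ActC M C) λ σ → (τ : ActC M (co C)) →
                      M , Model.o M s (merge M C σ τ) ⊨ φ)

⊨_ : ∀ {n} → Form n → Set₁
⊨_ {n} φ = (M : Model n) (s : Model.S M) → M , s ⊨ φ

{-# OPTIONS --safe #-}
-- Iab C φ says that C cannot enforce φ, so Iab C is antitone rather than
-- monotone.  A contradiction implies everything, yet no coalition can enforce
-- it, while every coalition enforces a tautology because action sets are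
-- non-empty; hence Iab C ⊥ → Iab C ⊤ fails at every state of every model.
module Submission where

open import Defs
open import Data.Nat using (ℕ; suc)
open import Data.Bool using (true)
open import Data.Product using (Σ; _×_; _,_)
open import Data.Empty using (⊥-elim)
open import Data.Unit using (⊤; tt)
open import Relation.Nullary using (¬_)

module _ {n : ℕ} where

  ⊥' : Form n
  ⊥' = var 0 ∧' (¬' var 0)

  ⊤' : Form n
  ⊤' = ¬' ⊥'

  ⇒'-intro : ∀ {M : Model n} {s φ ψ} → (M , s ⊨ φ → M , s ⊨ ψ) → M , s ⊨ φ ⇒' ψ
  ⇒'-intro f (a , ¬b) = ¬b (f a)

  ⇒'-refute : ∀ {M : Model n} {s φ ψ} → M , s ⊨ φ → ¬ (M , s ⊨ ψ) → ¬ (M , s ⊨ φ ⇒' ψ)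
  ⇒'-refute a ¬b imp = imp (a , ¬b)

  ⊭-⊥' : ∀ {M : Model n} {s} → ¬ (M , s ⊨ ⊥')
  ⊭-⊥' (a , ¬a) = ¬a a

  ⊨-⊥'⇒' : ∀ ψ → ⊨ (⊥' ⇒' ψ)
  ⊨-⊥'⇒' ψ M _ = ⇒'-intro {M = M} {φ = ⊥'} {ψ = ψ} λ contra → ⊥-elim (⊭-⊥' {M = M} contra)

  ⊨-Iab-⊥' : ∀ C → ⊨ Iab C ⊥'
  ⊨-Iab-⊥' _ M _ (_ , enforce) = ⊭-⊥' {M = M} (enforce λ i _ → Model.act₀ M i)

  ⊭-Iab-⊤' : ∀ C (M : Model n) s → ¬ (M , s ⊨ Iab C ⊤')
  ⊭-Iab-⊤' _ M _ cannot = cannot ((λ i _ → Model.act₀ M i) , λ _ → ⊭-⊥' {M = M})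

  trivialModel : Model n
  trivialModel = record
    { S = ⊤ ; s₀ = tt ; Act = λ _ → ⊤ ; act₀ = λ _ → tt ; o = λ _ _ → tt ; V = λ _ _ → ⊤ }

  ⊭-Iab-⊥'⇒'Iab-⊤' : ∀ C → ¬ (⊨ (Iab C ⊥' ⇒' Iab C ⊤'))
  ⊭-Iab-⊥'⇒'Iab-⊤' C valid =
    ⇒'-refute {M = trivialModel} {φ = Iab C ⊥'} {ψ = Iab C ⊤'}
      (⊨-Iab-⊥' C trivialModel tt) (⊭-Iab-⊤' C trivialModel tt) (valid trivialModel tt)

proposition4p6 : Σ ℕ λ n → Σ (Coalition (suc n)) λ C → Σ (Form (suc n)) λ φ → Σ (Form (suc n)) λ ψ →
    (⊨ (φ ⇒' ψ)) × ¬ (⊨ (Iab C φ ⇒' Iab C ψ))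
proposition4p6 = 0 , grand , ⊥' , ⊤' , ⊨-⊥'⇒' ⊤' , ⊭-Iab-⊥'⇒'Iab-⊤' grand
  where
  grand : Coalition 1
  grand _ = true
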